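{- Let $t\ge1$ and $n>1$ be integers, and let $\sigma=(t)\oplus L'(n)$, a sequence of length $n$. Consider the directed graph $G=(V,E)$ with $V=\{1,\dots,n\}$ and $E=\{(i,\sigma_i):1<i\le n\}$. Then $G$ consists of a self loop together with a path: there is exactly one vertex $v$ with $(v,v)\in E$, and the remaining $n-1$ vertices can be listed as $u_1,\dots,u_{n-1}$ so that $E\setminus\{(v,v)\}=\{(u_j,u_{j+1}):1\le j<n-1\}$.
   Context: For an integer $n>1$, let $p=0$ if $n$ is even and $p=1$ if $n$ is odd, and $w=\lfloor n/2\rfloor+2p$; $L'(n)$ is the sequence of length $n-1$ listing the elements of $\{1,\dots,n\}\setminus\{w\}$ in decreasing order, i.e. $L'(n)=(n,n-1,\dots,w+1,w-1,\dots,2,1)$. $\oplus$ denotes concatenation. -}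

module Defs where

open import Data.Nat using (ℕ; zero; suc; _+_; _*_; _∸_; _<_; _≤_; _/_; _%_)
open import Data.Nat.Properties using (_≟_)
open import Data.List using (List; []; _∷_; map; downFrom; filter)
open import Data.Product using (_×_)
open import Relation.Nullary using (¬?)
open import Relation.Binary.PropositionalEquality using (_≡_)

w : ℕ → ℕ
w n = n / 2 + 2 * (n % 2)

down1 : ℕ → List ℕ
down1 n = map suc (downFrom n)

L′ : ℕ → List ℕ
L′ n = filter (λ k → ¬? (k ≟ w n)) (down1 n)

σseq : ℕ → ℕ → List ℕ
σseq t n = t ∷ L′ n

-- 0-based list indexing with default 0 (only used in range)
nth : List ℕ → ℕ → ℕ
nth [] _ = 0
nth (x ∷ xs) zero = x
nth (x ∷ xs) (suc j) = nth xs j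

σ : ℕ → ℕ → ℕ → ℕ
σ t n i = nth (σseq t n) (i ∸ 1)

Edge : ℕ → ℕ → ℕ → ℕ → Set
Edge t n a b = (1 < a) × (a ≤ n) × (b ≡ σ t n a)

module Submission where

-- For i ≥ 2 the only edge out of i goes to σᵢ, and σ is a pair of reflections:
-- σᵢ = n + 2 − i while i + w ≤ n + 1, and σᵢ = n + 1 − i beyond that. The
-- midpoint v = ⌊n/2⌋ + 1 is fixed (by the first reflection when n is even, by the
-- second when n is odd), and alternating the two reflections walks the zigzag
-- k+1, hi, k, hi+1, …, 2, hi+k−1, 1 between the lower and the upper half (preceded
-- by v + 1 when n is odd), ending at 1, which has no outgoing edge. Together with
-- v this walk lists {1, …, n} without repetition, and that alone forces the edges
-- to be exactly the loop at v and the consecutive pairs of the walk.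

open import Defs
open import Data.Nat using (ℕ; zero; suc; _+_; _*_; _∸_; pred; _<_; _≤_; z≤n; s≤s; _/_; _%_)
open import Data.Nat.Properties
open import Data.Nat.DivMod using (m≡m%n+[m/n]*n; m%n<n)
open import Data.List using (List; []; _∷_; [_]; length; map; downFrom; filter; _++_; _∷ʳ_)
open import Data.List.Properties using (filter-accept; filter-reject; length-map; length-downFrom; ++-assoc)
open import Data.List.Membership.Propositional using (_∈_)
open import Data.List.Membership.Propositional.Properties using (∈-map⁺; ∈-map⁻; ∈-downFrom⁺; ∈-downFrom⁻)
open import Data.List.Relation.Unary.Any using (here; there)
open import Data.List.Relation.Unary.All as All using (All)
open import Data.List.Relation.Unary.AllPairs as AllPairs using (_∷_)
open import Data.List.Relation.Unary.Unique.Propositional using (Unique)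
open import Data.List.Relation.Unary.Unique.Propositional.Properties using (map⁺; downFrom⁺)
open import Data.List.Relation.Binary.Permutation.Propositional
  using (_↭_; ↭-refl; ↭-sym; ↭-prep; ↭-swap; ↭⇒↭ₛ; module PermutationReasoning)
open import Data.List.Relation.Binary.Permutation.Propositional.Properties
  using (∈-resp-↭; ↭-length; ++-comm; ∷↭∷ʳ)
open import Data.List.Relation.Binary.Permutation.Setoid.Properties using (Unique-resp-↭)
open import Data.Product using (_×_; _,_; proj₁; proj₂; ∃-syntax)
open import Data.Sum as Sum using (_⊎_; inj₁; inj₂)
open import Data.Empty using (⊥-elim)
open import Function.Bundles using (_⇔_; mk⇔)
open import Relation.Nullary using (¬_; ¬?; yes; no)
open import Relation.Binary.PropositionalEquality
  using (_≡_; _≢_; refl; sym; trans; cong; cong₂; subst; ≢-sym; setoid; module ≡-Reasoning)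

interval : ℕ → ℕ → List ℕ
interval a l = map (a +_) (downFrom l)

length-down1 : ∀ n → length (down1 n) ≡ n
length-down1 n = trans (length-map suc (downFrom n)) (length-downFrom n)

∈-down1⁺ : ∀ {n a} → 1 ≤ a → a ≤ n → a ∈ down1 n
∈-down1⁺ {a = suc a} _ a≤n = ∈-map⁺ suc (∈-downFrom⁺ a≤n)

∈-down1⁻ : ∀ {n a} → a ∈ down1 n → 1 ≤ a × a ≤ n
∈-down1⁻ a∈ with ∈-map⁻ suc a∈
... | _ , x∈ , refl = s≤s z≤n , ∈-downFrom⁻ x∈

Unique-down1 : ∀ n → Unique (down1 n)
Unique-down1 n = map⁺ suc-injective (downFrom⁺ n)

nth-down1 : ∀ {n x} → x < n → nth (down1 n) x + x ≡ n
nth-down1 {suc n} {zero}  _        = +-identityʳ (suc n)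
nth-down1 {suc n} {suc x} (s≤s x<n) = trans (+-suc _ x) (cong suc (nth-down1 x<n))

down1-++ : ∀ l′ l → down1 (l′ + l) ≡ interval (suc l) l′ ++ down1 l
down1-++ zero     l = refl
down1-++ (suc l′) l = cong₂ _∷_ (cong suc (+-comm l′ l)) (down1-++ l′ l)

interval-∷ʳ : ∀ a l → interval (suc a) l ∷ʳ a ≡ interval a (suc l)
interval-∷ʳ a zero    = cong [_] (sym (+-identityʳ a))
interval-∷ʳ a (suc l) = cong₂ _∷_ (sym (+-suc a l)) (interval-∷ʳ a l)

-- L′ n is `without (w n) n`, so σ t n (2 + x) is by definition its x-th entry.
without : ℕ → ℕ → List ℕ
without c n = filter (λ k → ¬? (k ≟ c)) (down1 n)

without-below : ∀ {c n} → n < c → without c n ≡ down1 n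
without-below {n = zero}  _   = refl
without-below {c} {suc n} n<c =
  trans (filter-accept (λ k → ¬? (k ≟ c)) (<⇒≢ n<c))
        (cong (suc n ∷_) (without-below (<-trans (n<1+n n) n<c)))

nth-without-< : ∀ {c n x} → x + c < n → nth (without c n) x + x ≡ n
nth-without-< {c} {suc n} {x} x+c<n
  rewrite filter-accept (λ k → ¬? (k ≟ c)) {x = suc n} {xs = down1 n}
            (>⇒≢ (≤-trans (s≤s (m≤n+m c x)) x+c<n)) with x
... | zero  = +-identityʳ (suc n)
... | suc x = trans (+-suc _ x) (cong suc (nth-without-< (≤-pred x+c<n)))

nth-without-≥ : ∀ {c n x} → c ≤ n → n ≤ x + c → suc x < n → nth (without c n) x + suc x ≡ n
nth-without-≥ {c} {suc n} {x} c≤n n≤x+c sx<n with suc n ≟ c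
... | yes refl
  rewrite filter-reject (λ k → ¬? (k ≟ suc n)) {x = suc n} {xs = down1 n} (λ n≢n → n≢n refl)
        | without-below {suc n} {n} ≤-refl
  = trans (+-suc _ x) (cong suc (nth-down1 (≤-pred sx<n)))
... | no n≢c
  rewrite filter-accept (λ k → ¬? (k ≟ c)) {x = suc n} {xs = down1 n} n≢c with x
...   | zero  = ⊥-elim (n≢c (≤-antisym n≤x+c c≤n))
...   | suc x = trans (+-suc _ (suc x))
          (cong suc (nth-without-≥ (≤-pred (≤∧≢⇒< c≤n (≢-sym n≢c))) (≤-pred n≤x+c) (≤-pred sx<n)))

σ-reflect-low : ∀ t {n c i} → w n ≡ c → 2 ≤ i → i + c ≤ suc n → σ t n i + i ≡ 2 + n
σ-reflect-low t {n} {i = suc (suc x)} refl (s≤s (s≤s _)) i+c≤ = begin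
  σ t n (2 + x) + (2 + x)     ≡⟨ +-suc _ (suc x) ⟩
  suc (σ t n (2 + x) + suc x) ≡⟨ cong suc (+-suc _ x) ⟩
  2 + (σ t n (2 + x) + x)     ≡⟨ cong (2 +_) (nth-without-< (≤-pred i+c≤)) ⟩
  2 + n                       ∎
  where open ≡-Reasoning

σ-reflect-high : ∀ t {n c i} → w n ≡ c → c ≤ n → suc n < i + c → i ≤ n → σ t n i + i ≡ suc n
σ-reflect-high t {n} {i = zero}        refl c≤n n<i+c _ = ⊥-elim (<⇒≱ n<i+c (≤-trans c≤n (n≤1+n n)))
σ-reflect-high t {n} {i = suc zero}    refl c≤n n<i+c _ = ⊥-elim (<⇒≱ n<i+c (s≤s c≤n))
σ-reflect-high t {n} {i = suc (suc x)} refl c≤n n<i+c i≤n =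
  trans (+-suc _ (suc x)) (cong suc (nth-without-≥ c≤n (≤-pred (≤-pred n<i+c)) i≤n))

nth-∈ : ∀ {xs j} → j < length xs → nth xs j ∈ xs
nth-∈ {_ ∷ _}  {zero}  _          = here refl
nth-∈ {_ ∷ xs} {suc j} (s≤s j<l)  = there (nth-∈ j<l)

nth-suc-≢ : ∀ {xs j} → Unique xs → suc j < length xs → nth xs j ≢ nth xs (suc j)
nth-suc-≢ {_ ∷ _ ∷ _} {zero}  (x∉ ∷ _) _         = All.head x∉
nth-suc-≢ {_ ∷ _}     {suc j} (_ ∷ u)  (s≤s j<l) = nth-suc-≢ u j<l

data Path (f : ℕ → ℕ) (e : ℕ) : List ℕ → Set where
  end  : Path f e [ e ]
  link : ∀ {a b xs} → b ≡ f a → Path f e (b ∷ xs) → Path f e (a ∷ b ∷ xs)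

module _ {f : ℕ → ℕ} {e : ℕ} where

  ∈-path : ∀ {xs} → Path f e xs → e ∈ xs
  ∈-path end        = here refl
  ∈-path (link _ p) = there (∈-path p)

  path-step : ∀ {xs j} → Path f e xs → suc j < length xs → nth xs (suc j) ≡ f (nth xs j)
  path-step end (s≤s ())
  path-step {j = zero}  (link b≡fa _) _         = b≡fa
  path-step {j = suc j} (link _ p)    (s≤s j<l) = path-step p j<l

  path-position : ∀ {xs a} → Path f e xs → a ∈ xs →
    a ≡ e ⊎ ∃[ j ] (suc j < length xs × nth xs j ≡ a)
  path-position end        (here a≡e)  = inj₁ a≡e
  path-position (link _ _) (here a≡x)  = inj₂ (0 , s≤s (s≤s z≤n) , sym a≡x)
  path-position (link _ p) (there a∈) with path-position p a∈
  ... | inj₁ a≡e             = inj₁ a≡e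
  ... | inj₂ (j , j<l , a≡x) = inj₂ (suc j , s≤s j<l , a≡x)

  path-inner≢end : ∀ {xs j} → Path f e xs → Unique xs → suc j < length xs → nth xs j ≢ e
  path-inner≢end end _ (s≤s ())
  path-inner≢end {j = zero}  (link _ p) (x∉ ∷ _) _         = All.lookup x∉ (∈-path p)
  path-inner≢end {j = suc j} (link _ p) (_ ∷ u)  (s≤s j<l) = path-inner≢end p u j<l

FunEdge : (ℕ → ℕ) → ℕ → ℕ → ℕ → Set
FunEdge f n a b = (1 < a) × (a ≤ n) × (b ≡ f a)

SelfLoopWithPath : (ℕ → ℕ → Set) → ℕ → Set
SelfLoopWithPath E n =
  ∃[ v ] (E v v × (∀ v′ → E v′ v′ → v′ ≡ v) ×
    ∃[ us ] ((length us ≡ n ∸ 1) × ((v ∷ us) ↭ down1 n) ×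
      (∀ a b → ((E a b × ¬ (a ≡ v × b ≡ v)) ⇔
        (∃[ j ] ((suc j < length us) × (nth us j ≡ a) × (nth us (suc j) ≡ b)))))))

loop-and-path : ∀ {f n v us} → 1 < v → f v ≡ v → (v ∷ us) ↭ down1 n → Path f 1 us →
  SelfLoopWithPath (FunEdge f n) n
loop-and-path {f} {n} {v} {us} 1<v fv≡v v∷us↭ path =
  v , loop , loop-unique , us , length-us , v∷us↭ , λ a b → mk⇔ (edge⇒step a b) step⇒edge
  where
  v∷us-unique : Unique (v ∷ us)
  v∷us-unique = Unique-resp-↭ (setoid ℕ) (↭⇒↭ₛ (↭-sym v∷us↭)) (Unique-down1 n)

  v∉us : All (v ≢_) us
  v∉us = AllPairs.head v∷us-unique

  us-unique : Unique us
  us-unique = AllPairs.tail v∷us-unique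

  bounds : ∀ {a} → a ∈ (v ∷ us) → 1 ≤ a × a ≤ n
  bounds a∈ = ∈-down1⁻ (∈-resp-↭ v∷us↭ a∈)

  loop : FunEdge f n v v
  loop = 1<v , proj₂ (bounds (here refl)) , sym fv≡v

  loop-or-inner : ∀ {a} → 1 < a → a ≤ n → a ≡ v ⊎ ∃[ j ] (suc j < length us × nth us j ≡ a)
  loop-or-inner 1<a a≤n with ∈-resp-↭ (↭-sym v∷us↭) (∈-down1⁺ (<⇒≤ 1<a) a≤n)
  ... | here a≡v   = inj₁ a≡v
  ... | there a∈us = Sum.[ (λ a≡1 → ⊥-elim (>⇒≢ 1<a a≡1)) , inj₂ ] (path-position path a∈us)

  loop-unique : ∀ a → FunEdge f n a a → a ≡ v
  loop-unique a (1<a , a≤n , a≡fa) with loop-or-inner 1<a a≤n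
  ... | inj₁ a≡v            = a≡v
  ... | inj₂ (j , j<l , refl) = ⊥-elim (nth-suc-≢ us-unique j<l (trans a≡fa (sym (path-step path j<l))))

  length-us : length us ≡ n ∸ 1
  length-us = cong pred (trans (↭-length v∷us↭) (length-down1 n))

  edge⇒step : ∀ a b → FunEdge f n a b × ¬ (a ≡ v × b ≡ v) →
    ∃[ j ] (suc j < length us × nth us j ≡ a × nth us (suc j) ≡ b)
  edge⇒step a b ((1<a , a≤n , b≡fa) , not-loop) with loop-or-inner 1<a a≤n
  ... | inj₁ refl             = ⊥-elim (not-loop (refl , trans b≡fa fv≡v))
  ... | inj₂ (j , j<l , refl) = j , j<l , refl , trans (path-step path j<l) (sym b≡fa)

  step⇒edge : ∀ {a b} → ∃[ j ] (suc j < length us × nth us j ≡ a × nth us (suc j) ≡ b) →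
    FunEdge f n a b × ¬ (a ≡ v × b ≡ v)
  step⇒edge (j , j<l , refl , refl) =
    (1<a , proj₂ (bounds (there a∈us)) , path-step path j<l) , λ (a≡v , _) → All.lookup v∉us a∈us (sym a≡v)
    where
    a∈us : nth us j ∈ us
    a∈us = nth-∈ (≤-trans (n≤1+n _) j<l)

    1<a : 1 < nth us j
    1<a = ≤∧≢⇒< (proj₁ (bounds (there a∈us))) (≢-sym (path-inner≢end path us-unique j<l))

zig zigTail : ℕ → ℕ → List ℕ
zig k hi = suc k ∷ zigTail k hi
zigTail zero    hi = []
zigTail (suc k) hi = hi ∷ zig k (suc hi)

zig-↭ : ∀ k hi → zig k hi ↭ down1 (suc k) ++ interval hi k
zig-↭ zero    hi = ↭-refl
zig-↭ (suc k) hi = begin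
  2 + k ∷ hi ∷ zig k (suc hi)                           ↭⟨ ↭-prep _ (↭-prep hi (zig-↭ k (suc hi))) ⟩
  2 + k ∷ hi ∷ (down1 (suc k) ++ interval (suc hi) k)    ↭⟨ ↭-prep _ (∷↭∷ʳ hi _) ⟩
  2 + k ∷ ((down1 (suc k) ++ interval (suc hi) k) ∷ʳ hi) ≡⟨ cong (2 + k ∷_) (++-assoc (down1 (suc k)) _ [ hi ]) ⟩
  2 + k ∷ (down1 (suc k) ++ (interval (suc hi) k ∷ʳ hi)) ≡⟨ cong (λ hs → 2 + k ∷ (down1 (suc k) ++ hs)) (interval-∷ʳ hi k) ⟩
  2 + k ∷ (down1 (suc k) ++ interval hi (suc k))         ∎
  where open PermutationReasoning

module _ {f : ℕ → ℕ} {n c : ℕ}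
  (reflect-low  : ∀ {i} → 2 ≤ i → i + c ≤ suc n → f i + i ≡ 2 + n)
  (reflect-high : ∀ {i} → suc n < i + c → i ≤ n → f i + i ≡ suc n)
  where

  zig-path : ∀ k hi → k + hi ≡ suc n → suc k + c ≤ suc n → suc n < hi + c → Path f 1 (zig k hi)
  zig-path zero    hi _   _     _     = end
  zig-path (suc k) hi inv lo≤ n<hi = link low-step (link high-step
    (zig-path k (suc hi) (trans (+-suc k hi) inv) (≤-trans (n≤1+n _) lo≤) (m<n⇒m<1+n n<hi)))
    where
    low-step : hi ≡ f (2 + k)
    low-step = +-cancelʳ-≡ (2 + k) _ _
      (trans (trans (+-comm hi (2 + k)) (cong suc inv)) (sym (reflect-low (s≤s (s≤s z≤n)) lo≤)))

    high-step : suc k ≡ f hi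
    high-step = +-cancelʳ-≡ hi _ _
      (trans inv (sym (reflect-high n<hi (subst (hi ≤_) (suc-injective inv) (m≤n+m hi k)))))

w-parity : ∀ n → ∃[ q ] (n ≡ q + q × w n ≡ q) ⊎ ∃[ q ] (n ≡ suc (q + q) × w n ≡ 2 + q)
w-parity n = by-remainder (n % 2) refl (m%n<n n 2)
  where
  q : ℕ
  q = n / 2

  q*2≡q+q : q * 2 ≡ q + q
  q*2≡q+q = trans (*-comm q 2) (cong (q +_) (+-identityʳ q))

  by-remainder : ∀ r → n % 2 ≡ r → r < 2 →
    ∃[ q ] (n ≡ q + q × w n ≡ q) ⊎ ∃[ q ] (n ≡ suc (q + q) × w n ≡ 2 + q)
  by-remainder zero       r≡0 _ = inj₁ (q ,
    trans (m≡m%n+[m/n]*n n 2) (cong₂ _+_ r≡0 q*2≡q+q) ,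
    trans (cong (λ r → q + 2 * r) r≡0) (+-identityʳ q))
  by-remainder (suc zero) r≡1 _ = inj₂ (q ,
    trans (m≡m%n+[m/n]*n n 2) (cong₂ _+_ r≡1 q*2≡q+q) ,
    trans (cong (λ r → q + 2 * r) r≡1) (+-comm q 2))
  by-remainder (suc (suc _)) _ (s≤s (s≤s ()))

module _ (t k : ℕ) where

  even-case : w (suc k + suc k) ≡ suc k → SelfLoopWithPath (Edge t (suc k + suc k)) (suc k + suc k)
  even-case w≡ = loop-and-path (s≤s (s≤s z≤n)) fixed perm path
    where
    n v : ℕ
    n = suc k + suc k
    v = 2 + k

    k+[2+k]≡n : k + (2 + k) ≡ n
    k+[2+k]≡n = +-suc k (suc k)

    fixed : σ t n v ≡ v
    fixed = +-cancelʳ-≡ v _ _ (trans (σ-reflect-low t w≡ (s≤s (s≤s z≤n)) ≤-refl) (cong (2 +_) (sym k+[2+k]≡n)))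

    path : Path (σ t n) 1 (zig k (3 + k))
    path = zig-path (σ-reflect-low t w≡) (σ-reflect-high t w≡ (m≤m+n (suc k) (suc k)))
      k (3 + k) (trans (+-suc k (2 + k)) (cong suc k+[2+k]≡n)) (n≤1+n n) ≤-refl

    perm : (v ∷ zig k (3 + k)) ↭ down1 n
    perm = begin
      v ∷ zig k (3 + k)                   ↭⟨ ↭-prep v (zig-↭ k (3 + k)) ⟩
      down1 (2 + k) ++ interval (3 + k) k ↭⟨ ++-comm (down1 (2 + k)) _ ⟩
      interval (3 + k) k ++ down1 (2 + k) ≡⟨ sym (down1-++ k (2 + k)) ⟩
      down1 (k + (2 + k))                 ≡⟨ cong down1 k+[2+k]≡n ⟩
      down1 n                             ∎
      where open PermutationReasoning

  odd-case : w (suc (suc k + suc k)) ≡ 3 + k →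
    SelfLoopWithPath (Edge t (suc (suc k + suc k))) (suc (suc k + suc k))
  odd-case w≡ = loop-and-path (s≤s (s≤s z≤n)) fixed perm (link head-step path)
    where
    n v : ℕ
    n = suc (suc k + suc k)
    v = 2 + k

    head≤n : 3 + k ≤ n
    head≤n = s≤s (s≤s (m≤n+m (suc k) k))

    reflect-high : ∀ {i} → suc n < i + (3 + k) → i ≤ n → σ t n i + i ≡ suc n
    reflect-high = σ-reflect-high t w≡ head≤n

    n<v+w : suc n < v + (3 + k)
    n<v+w = ≤-reflexive (sym (trans (cong (2 +_) (+-suc k (2 + k))) (cong (3 +_) (+-suc k (suc k)))))

    fixed : σ t n v ≡ v
    fixed = +-cancelʳ-≡ v _ _
      (trans (reflect-high n<v+w (s≤s (s≤s (m≤m+n k (suc k))))) (cong (2 +_) (sym (+-suc k (suc k)))))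

    k+[3+k]≡n : k + (3 + k) ≡ n
    k+[3+k]≡n = trans (+-suc k (2 + k)) (cong suc (+-suc k (suc k)))

    head-step : suc k ≡ σ t n (3 + k)
    head-step = +-cancelʳ-≡ (3 + k) _ _
      (trans (cong suc k+[3+k]≡n) (sym (reflect-high (m<n⇒m<1+n n<v+w) head≤n)))

    path : Path (σ t n) 1 (zig k (4 + k))
    path = zig-path (σ-reflect-low t w≡) reflect-high k (4 + k)
      (trans (+-suc k (3 + k)) (cong suc k+[3+k]≡n)) (≤-reflexive (cong suc k+[3+k]≡n))
      (m<n⇒m<1+n (m<n⇒m<1+n n<v+w))

    perm : (v ∷ 3 + k ∷ zig k (4 + k)) ↭ down1 n
    perm = begin
      v ∷ 3 + k ∷ zig k (4 + k)                          ↭⟨ ↭-prep v (↭-prep (3 + k) (zig-↭ k (4 + k))) ⟩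
      v ∷ 3 + k ∷ (down1 (suc k) ++ interval (4 + k) k)  ↭⟨ ↭-swap v (3 + k) ↭-refl ⟩
      down1 (3 + k) ++ interval (4 + k) k                ↭⟨ ++-comm (down1 (3 + k)) _ ⟩
      interval (4 + k) k ++ down1 (3 + k)                ≡⟨ sym (down1-++ k (3 + k)) ⟩
      down1 (k + (3 + k))                                ≡⟨ cong down1 k+[3+k]≡n ⟩
      down1 n                                            ∎
      where open PermutationReasoning

-- σ₁ = t labels no edge.
lemma4p5 : (t n : ℕ) → 1 ≤ t → 1 < n →
    ∃[ v ] (Edge t n v v × (∀ v′ → Edge t n v′ v′ → v′ ≡ v) ×
      ∃[ us ] ((length us ≡ n ∸ 1) × ((v ∷ us) ↭ down1 n) ×
        (∀ a b → ((Edge t n a b × ¬ (a ≡ v × b ≡ v)) ⇔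
          (∃[ j ] ((suc j < length us) × (nth us j ≡ a) × (nth us (suc j) ≡ b)))))))
lemma4p5 t n _ 1<n with w-parity n
... | inj₁ (zero  , refl , _)  = ⊥-elim (n≮0 1<n)
... | inj₁ (suc k , refl , w≡) = even-case t k w≡
... | inj₂ (zero  , refl , _)  = ⊥-elim (<-irrefl refl 1<n)
... | inj₂ (suc k , refl , w≡) = odd-case t k w≡
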